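{- Let $Q$ and $R$ be delta operators and $a\in\mathbb K$. If $Q/R=\sum_{k\ge0}a_kQ^k$ with $a_k\in\mathbb K$, then \[ R^{ -1}_{(a)}-a_0Q^{ -1}_{(a)}=\sum_{k=1}^\infty a_k(1-\mathcal E_a)Q^{k-1}. \]
   Context: $\mathbb K$ is a field of characteristic zero; operators are linear maps on $\mathbb K[x]$; $D=d/dx$, $E^a f(x)=f(x+a)$. A delta operator is an operator commuting with all shifts, with $Qx$ a nonzero constant; it is a power series in $D$ of the form $DP$ with $P$ invertible. For delta operators $Q=DP$, $R=DS$, $Q/R\defeq PS^{ -1}$. $\mathcal E_a$ sends $f$ to the constant polynomial $f(a)$. The sigma operator $Q^{ -1}$ of $Q$ is the unique linear operator with $QQ^{ -1}=1$, $Q^{ -1}Q=1-\mathcal E_0$, and $Q^{ -1}_{(a)}\defeq E^{ -a}Q^{ -1}E^a$. Series in powers of $Q$ act on polynomials as finite sums. -}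

module Defs where

open import Level using (Level; _⊔_)
open import Algebra.Bundles using (CommutativeRing)
open import Data.Nat using (ℕ; zero; suc)
open import Data.List using (List; []; _∷_; length; map)
open import Data.Product using (Σ; _×_; _,_)
open import Relation.Nullary using (¬_)

record Field (c ℓ : Level) : Set (Level.suc (c ⊔ ℓ)) where
  field
    commutativeRing : CommutativeRing c ℓ
  open CommutativeRing commutativeRing public
  field
    0≉1     : ¬ (0# ≈ 1#)
    inverse : ∀ x → ¬ (x ≈ 0#) → Σ Carrier (λ y → x * y ≈ 1#)

module Umbral {c ℓ : Level} (F : Field c ℓ) where
  open Field F

  fromℕ : ℕ → Carrier
  fromℕ zero    = 0#
  fromℕ (suc n) = 1# + fromℕ n

  CharZero : Set ℓ
  CharZero = ∀ n → ¬ (fromℕ (suc n) ≈ 0#)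

  -- Polynomials K[x]: coefficient lists, lowest degree first.
  Poly : Set c
  Poly = List Carrier

  coeff : Poly → ℕ → Carrier
  coeff []      _       = 0#
  coeff (a ∷ p) zero    = a
  coeff (a ∷ p) (suc n) = coeff p n

  -- equality of polynomials: all coefficients agree (trailing zeros ignored)
  infix 4 _≈ₚ_
  _≈ₚ_ : Poly → Poly → Set ℓ
  p ≈ₚ q = ∀ n → coeff p n ≈ coeff q n

  infixl 6 _+ₚ_ _-ₚ_
  infixl 7 _*ₚ_

  _+ₚ_ : Poly → Poly → Poly
  []      +ₚ q       = q
  (a ∷ p) +ₚ []      = a ∷ p
  (a ∷ p) +ₚ (b ∷ q) = (a + b) ∷ (p +ₚ q)

  scale : Carrier → Poly → Poly
  scale k p = map (k *_) p

  _-ₚ_ : Poly → Poly → Poly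
  p -ₚ q = p +ₚ scale (- 1#) q

  _*ₚ_ : Poly → Poly → Poly
  []      *ₚ q = []
  (a ∷ p) *ₚ q = scale a q +ₚ (0# ∷ (p *ₚ q))

  X : Poly
  X = 0# ∷ 1# ∷ []

  eval : Carrier → Poly → Carrier
  eval a []      = 0#
  eval a (b ∷ p) = b + a * eval a p

  Op : Set c
  Op = Poly → Poly

  infix 4 _≈ₒ_
  _≈ₒ_ : Op → Op → Set (c ⊔ ℓ)
  S ≈ₒ T = ∀ p → S p ≈ₚ T p

  idₒ : Op
  idₒ p = p

  infixr 9 _∘ₒ_
  _∘ₒ_ : Op → Op → Op
  (S ∘ₒ T) p = S (T p)

  infixl 6 _-ₒ_
  _-ₒ_ : Op → Op → Op
  (S -ₒ T) p = S p -ₚ T p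

  _^ₒ_ : Op → ℕ → Op
  T ^ₒ zero  = idₒ
  T ^ₒ suc k = T ∘ₒ (T ^ₒ k)

  record IsLinear (T : Op) : Set (c ⊔ ℓ) where
    field
      cong  : ∀ {p q} → p ≈ₚ q → T p ≈ₚ T q
      additive : ∀ p q → T (p +ₚ q) ≈ₚ T p +ₚ T q
      homogeneous : ∀ k p → T (scale k p) ≈ₚ scale k (T p)

  -- D = d/dx :  (b + x g)' = g + x g'
  D : Op
  D []      = []
  D (b ∷ p) = p +ₚ (0# ∷ D p)

  -- shift E^a f(x) = f(x + a) :  (b + x g)(x+a) = b + (x + a) g(x + a)
  E : Carrier → Op
  E a []      = []
  E a (b ∷ p) = (b ∷ []) +ₚ ((a ∷ 1# ∷ []) *ₚ E a p)

  𝓔 : Carrier → Op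
  𝓔 a p = eval a p ∷ []

  ShiftInvariant : Op → Set (c ⊔ ℓ)
  ShiftInvariant T = ∀ a p → T (E a p) ≈ₚ E a (T p)

  IsDelta : Op → Set (c ⊔ ℓ)
  IsDelta Q = IsLinear Q × ShiftInvariant Q
            × Σ Carrier (λ k → ¬ (k ≈ 0#) × Q X ≈ₚ (k ∷ []))

  -- T is Q/R: Q = D P, R = D S (P, S shift-invariant, S invertible), T = P S⁻¹
  IsQuotient : Op → Op → Op → Set (c ⊔ ℓ)
  IsQuotient Q R T =
    Σ Op λ P → Σ Op λ S → Σ Op λ S⁻¹ →
      (IsLinear P × ShiftInvariant P) × (IsLinear S × ShiftInvariant S) × IsLinear S⁻¹
      × (D ∘ₒ P ≈ₒ Q) × (D ∘ₒ S ≈ₒ R)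
      × (S ∘ₒ S⁻¹ ≈ₒ idₒ) × (S⁻¹ ∘ₒ S ≈ₒ idₒ)
      × (T ≈ₒ P ∘ₒ S⁻¹)

  IsSigma : Op → Op → Set (c ⊔ ℓ)
  IsSigma Q Σ' = IsLinear Σ' × (Q ∘ₒ Σ' ≈ₒ idₒ) × (Σ' ∘ₒ Q ≈ₒ idₒ -ₒ 𝓔 0#)

  conj : Carrier → Op → Op
  conj a T = E (- a) ∘ₒ T ∘ₒ E a

  sumₚ : ℕ → (ℕ → Poly) → Poly
  sumₚ zero    f = []
  sumₚ (suc n) f = sumₚ n f +ₚ f n

  -- action of the series Σ_{k ≥ 0} a_k Q^k on a polynomial p; for a delta
  -- operator Q, Q^k p = 0 once k ≥ length p (> deg p), so this finite sum
  -- is the full (finite) sum.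
  seriesQ : (ℕ → Carrier) → Op → Op
  seriesQ as Q p = sumₚ (length p) (λ k → scale (as k) ((Q ^ₒ k) p))

{-# OPTIONS --safe #-}

-- Put g = Eᵃ f and h = Q⁻¹ g, so that Q h = g and h(0) = 0.  Shift-invariant operators
-- commute: by Taylor's formula Eᵃ = ∑ aᵏ Dᵏ/k! they commute with the Hasse derivatives
-- Dᵏ/k!, so each is ∑ tᵢ Dⁱ/i! with tᵢ the constant term of its value on xⁱ, and the
-- constant term of A (B q) is symmetric in A and B.  Hence R (Q/R) = D S P S⁻¹ = D P = Q, and
--   R⁻¹ g = R⁻¹ R (Q/R) h = (1 − 𝓔₀) ∑ₖ aₖ Qᵏ h = a₀ h + ∑ₖ₌₁ aₖ (1 − 𝓔₀) Eᵃ Qᵏ⁻¹ f,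
-- a finite sum because a delta operator kills constants and so lowers degrees.  Conjugating
-- by Eᵃ turns 1 − 𝓔₀ into 1 − 𝓔ₐ.  All polynomial identities are checked pointwise, which
-- suffices because in characteristic zero a polynomial is determined by its values.
module Submission where

open import Algebra.Bundles using (CommutativeRing)
open import Algebra.Solver.Ring.AlmostCommutativeRing using (_-Raw-AlmostCommutative⟶_; fromCommutativeRing)
open import Data.Integer as ℤ using (ℤ; +_; -[1+_]; _◃_; sign; ∣_∣)
import Data.Integer.Properties as ℤP
open import Data.List using ([]; _∷_; length)
open import Data.Maybe using (Maybe; just; nothing)
open import Data.Nat as ℕ using (ℕ; zero; suc; _≤_; _<_; z≤n; s≤s)
import Data.Nat.Properties as ℕP
open import Data.Product using (_,_; proj₁)
open import Data.Sign as Sign using (Sign)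
open import Data.Sum using (inj₁; inj₂)
open import Defs
open import Level using (Level)
open import Relation.Binary.Bundles using (Setoid)
open import Relation.Binary.PropositionalEquality as ≡ using (_≡_; _≢_)
import Relation.Binary.Reasoning.Setoid
open import Relation.Binary.Structures using (IsEquivalence)
open import Relation.Nullary using (¬_; yes; no; contradiction)

-- The ring solver with integer coefficients, so that the normal forms it compares are computed in ℤ.
module CommutativeRingSolver {c ℓ : Level} (R : CommutativeRing c ℓ) where
  open CommutativeRing R
  open import Relation.Binary.Reasoning.Setoid setoid
  open import Algebra.Properties.Semiring.Mult.TCOptimised semiring using (_×_; 1+×; ×-homo-+; ×1-homo-*)
  open import Algebra.Properties.Ring ring using (-‿distribˡ-*; -‿distribʳ-*; -‿involutive; -0#≈0#; -‿+-comm)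

  ⟦_⟧ℤ : ℤ → Carrier
  ⟦ + n ⟧ℤ      = n × 1#
  ⟦ -[1+ n ] ⟧ℤ = - (suc n × 1#)

  applySign : Sign → Carrier → Carrier
  applySign Sign.+ x = x
  applySign Sign.- x = - x

  applySign-cong : ∀ s {x y} → x ≈ y → applySign s x ≈ applySign s y
  applySign-cong Sign.+ x≈y = x≈y
  applySign-cong Sign.- x≈y = -‿cong x≈y

  applySign-* : ∀ s t x y → applySign (s Sign.* t) (x * y) ≈ applySign s x * applySign t y
  applySign-* Sign.+ Sign.+ x y = refl
  applySign-* Sign.+ Sign.- x y = -‿distribʳ-* x y
  applySign-* Sign.- Sign.+ x y = -‿distribˡ-* x y
  applySign-* Sign.- Sign.- x y = begin
    x * y         ≈⟨ -‿involutive (x * y) ⟨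
    - - (x * y)   ≈⟨ -‿cong (-‿distribˡ-* x y) ⟩
    - (- x * y)   ≈⟨ -‿distribʳ-* (- x) y ⟩
    - x * - y     ∎

  ⟦◃⟧ : ∀ s n → ⟦ s ◃ n ⟧ℤ ≈ applySign s (n × 1#)
  ⟦◃⟧ Sign.+ zero    = refl
  ⟦◃⟧ Sign.- zero    = sym -0#≈0#
  ⟦◃⟧ Sign.+ (suc n) = refl
  ⟦◃⟧ Sign.- (suc n) = refl

  ⟦sign◃∣∣⟧ : ∀ i → applySign (sign i) (∣ i ∣ × 1#) ≈ ⟦ i ⟧ℤ
  ⟦sign◃∣∣⟧ (+ n)      = refl
  ⟦sign◃∣∣⟧ -[1+ n ]   = refl

  ⟦⟧-*-homo : ∀ i j → ⟦ i ℤ.* j ⟧ℤ ≈ ⟦ i ⟧ℤ * ⟦ j ⟧ℤ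
  ⟦⟧-*-homo i j = begin
    ⟦ sign i Sign.* sign j ◃ ∣ i ∣ ℕ.* ∣ j ∣ ⟧ℤ                ≈⟨ ⟦◃⟧ (sign i Sign.* sign j) (∣ i ∣ ℕ.* ∣ j ∣) ⟩
    applySign (sign i Sign.* sign j) ((∣ i ∣ ℕ.* ∣ j ∣) × 1#)    ≈⟨ applySign-cong (sign i Sign.* sign j) (×1-homo-* ∣ i ∣ ∣ j ∣) ⟩
    applySign (sign i Sign.* sign j) ((∣ i ∣ × 1#) * (∣ j ∣ × 1#)) ≈⟨ applySign-* (sign i) (sign j) _ _ ⟩
    applySign (sign i) (∣ i ∣ × 1#) * applySign (sign j) (∣ j ∣ × 1#) ≈⟨ *-cong (⟦sign◃∣∣⟧ i) (⟦sign◃∣∣⟧ j) ⟩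
    ⟦ i ⟧ℤ * ⟦ j ⟧ℤ                                            ∎

  ⟦⟧-‿homo : ∀ i → ⟦ ℤ.- i ⟧ℤ ≈ - ⟦ i ⟧ℤ
  ⟦⟧-‿homo (+ zero)  = sym -0#≈0#
  ⟦⟧-‿homo (+ suc n) = refl
  ⟦⟧-‿homo -[1+ n ]  = sym (-‿involutive _)

  1+x-[1+y]≈x-y : ∀ x y → (1# + x) - (1# + y) ≈ x - y
  1+x-[1+y]≈x-y x y = begin
    (1# + x) - (1# + y)     ≈⟨ +-congˡ (-‿+-comm 1# y) ⟨
    (1# + x) + (- 1# - y)   ≈⟨ +-assoc 1# x _ ⟩
    1# + (x + (- 1# - y))   ≈⟨ +-congˡ (+-assoc x (- 1#) (- y)) ⟨
    1# + ((x - 1#) - y)     ≈⟨ +-congˡ (+-congʳ (+-comm x (- 1#))) ⟩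
    1# + ((- 1# + x) - y)   ≈⟨ +-congˡ (+-assoc (- 1#) x (- y)) ⟩
    1# + (- 1# + (x - y))   ≈⟨ +-assoc 1# (- 1#) _ ⟨
    (1# - 1#) + (x - y)     ≈⟨ +-congʳ (-‿inverseʳ 1#) ⟩
    0# + (x - y)            ≈⟨ +-identityˡ _ ⟩
    x - y                   ∎

  ⟦⊖⟧ : ∀ m n → ⟦ m ℤ.⊖ n ⟧ℤ ≈ m × 1# - n × 1#
  ⟦⊖⟧ zero    zero    = sym (-‿inverseʳ 0#)
  ⟦⊖⟧ zero    (suc n) = sym (+-identityˡ _)
  ⟦⊖⟧ (suc m) zero    = sym (trans (+-congˡ -0#≈0#) (+-identityʳ _))
  ⟦⊖⟧ (suc m) (suc n) rewrite ℤP.[1+m]⊖[1+n]≡m⊖n m n = begin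
    ⟦ m ℤ.⊖ n ⟧ℤ                   ≈⟨ ⟦⊖⟧ m n ⟩
    m × 1# - n × 1#                ≈⟨ 1+x-[1+y]≈x-y (m × 1#) (n × 1#) ⟨
    (1# + m × 1#) - (1# + n × 1#)  ≈⟨ +-cong (1+× m 1#) (-‿cong (1+× n 1#)) ⟨
    suc m × 1# - suc n × 1#        ∎

  ⟦⟧-+-homo : ∀ i j → ⟦ i ℤ.+ j ⟧ℤ ≈ ⟦ i ⟧ℤ + ⟦ j ⟧ℤ
  ⟦⟧-+-homo -[1+ m ] -[1+ n ] = begin
    - (suc (suc (m ℕ.+ n)) × 1#)      ≡⟨ ≡.cong (λ k → - (suc k × 1#)) (ℕP.+-suc m n) ⟨
    - ((suc m ℕ.+ suc n) × 1#)        ≈⟨ -‿cong (×-homo-+ 1# (suc m) (suc n)) ⟩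
    - (suc m × 1# + suc n × 1#)       ≈⟨ -‿+-comm _ _ ⟨
    - (suc m × 1#) - suc n × 1#       ∎
  ⟦⟧-+-homo -[1+ m ] (+ n)    = trans (⟦⊖⟧ n (suc m)) (+-comm _ _)
  ⟦⟧-+-homo (+ m)    -[1+ n ] = ⟦⊖⟧ m (suc n)
  ⟦⟧-+-homo (+ m)    (+ n)    = ×-homo-+ 1# m n

  ⟦⟧-homomorphism : ℤ.+-*-rawRing -Raw-AlmostCommutative⟶ fromCommutativeRing R
  ⟦⟧-homomorphism = record
    { ⟦_⟧    = ⟦_⟧ℤ
    ; +-homo = ⟦⟧-+-homo
    ; *-homo = ⟦⟧-*-homo
    ; -‿homo = ⟦⟧-‿homo
    ; 0-homo = refl
    ; 1-homo = refl
    }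

  ⟦⟧-weaklyDecidable : ∀ i j → Maybe (⟦ i ⟧ℤ ≈ ⟦ j ⟧ℤ)
  ⟦⟧-weaklyDecidable i j with i ℤ.≟ j
  ... | yes ≡.refl = just refl
  ... | no _       = nothing

  open import Algebra.Solver.Ring ℤ.+-*-rawRing (fromCommutativeRing R) ⟦⟧-homomorphism ⟦⟧-weaklyDecidable public
    using (solve; _:=_; _:+_; _:*_; :-_; _:-_; con)

module FiniteSums {c ℓ : Level} (R : CommutativeRing c ℓ) where
  open CommutativeRing R
  open import Relation.Binary.Reasoning.Setoid setoid
  open CommutativeRingSolver R

  ∑ : ℕ → (ℕ → Carrier) → Carrier
  ∑ zero    f = 0#
  ∑ (suc n) f = ∑ n f + f n

  syntax ∑ n (λ i → x) = ∑[ i < n ] x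

  ∑-cong : ∀ n {f g : ℕ → Carrier} → (∀ i → f i ≈ g i) → ∑ n f ≈ ∑ n g
  ∑-cong zero    f≈g = refl
  ∑-cong (suc n) f≈g = +-cong (∑-cong n f≈g) (f≈g n)

  ∑-zero : ∀ n {f : ℕ → Carrier} → (∀ i → i < n → f i ≈ 0#) → ∑ n f ≈ 0#
  ∑-zero zero    f≈0 = refl
  ∑-zero (suc n) {f} f≈0 = begin
    ∑ n f + f n  ≈⟨ +-cong (∑-zero n (λ i i<n → f≈0 i (ℕP.m<n⇒m<1+n i<n))) (f≈0 n ℕP.≤-refl) ⟩
    0# + 0#      ≈⟨ +-identityˡ 0# ⟩
    0#           ∎

  ∑-distrib-+ : ∀ n (f g : ℕ → Carrier) → ∑[ i < n ] (f i + g i) ≈ ∑ n f + ∑ n g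
  ∑-distrib-+ zero    f g = sym (+-identityˡ 0#)
  ∑-distrib-+ (suc n) f g = begin
    ∑[ i < n ] (f i + g i) + (f n + g n)   ≈⟨ +-congʳ (∑-distrib-+ n f g) ⟩
    (∑ n f + ∑ n g) + (f n + g n)          ≈⟨ solve 4 (λ a b x y → (a :+ b) :+ (x :+ y) := (a :+ x) :+ (b :+ y)) refl _ _ _ _ ⟩
    (∑ n f + f n) + (∑ n g + g n)          ∎

  *-distribˡ-∑ : ∀ n x (f : ℕ → Carrier) → x * ∑ n f ≈ ∑[ i < n ] (x * f i)
  *-distribˡ-∑ zero    x f = zeroʳ x
  *-distribˡ-∑ (suc n) x f = trans (distribˡ x _ _) (+-congʳ (*-distribˡ-∑ n x f))

  *-distribʳ-∑ : ∀ n x (f : ℕ → Carrier) → ∑ n f * x ≈ ∑[ i < n ] (f i * x)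
  *-distribʳ-∑ n x f = trans (*-comm _ x) (trans (*-distribˡ-∑ n x f) (∑-cong n (λ i → *-comm x (f i))))

  ∑-distrib-- : ∀ n (f g : ℕ → Carrier) → ∑[ i < n ] (f i - g i) ≈ ∑ n f - ∑ n g
  ∑-distrib-- zero    f g = sym (-‿inverseʳ 0#)
  ∑-distrib-- (suc n) f g = begin
    ∑[ i < n ] (f i - g i) + (f n - g n)   ≈⟨ +-congʳ (∑-distrib-- n f g) ⟩
    (∑ n f - ∑ n g) + (f n - g n)          ≈⟨ solve 4 (λ a b x y → (a :- b) :+ (x :- y) := (a :+ x) :- (b :+ y)) refl _ _ _ _ ⟩
    (∑ n f + f n) - (∑ n g + g n)          ∎

  ∑-suc : ∀ n (f : ℕ → Carrier) → ∑ (suc n) f ≈ f 0 + ∑[ i < n ] (f (suc i))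
  ∑-suc zero    f = trans (+-identityˡ (f 0)) (sym (+-identityʳ (f 0)))
  ∑-suc (suc n) f = trans (+-congʳ (∑-suc n f)) (+-assoc _ _ _)

  ∑-extend : ∀ {m} n {f : ℕ → Carrier} → m ≤ n → (∀ i → m ≤ i → f i ≈ 0#) → ∑ n f ≈ ∑ m f
  ∑-extend zero    ℕ.z≤n _   = refl
  ∑-extend (suc n) m≤1+n f≈0 with ℕP.m≤n⇒m<n∨m≡n m≤1+n
  ... | inj₁ (ℕ.s≤s m≤n) = trans (+-cong (∑-extend n m≤n f≈0) (f≈0 n m≤n)) (+-identityʳ _)
  ... | inj₂ ≡.refl      = refl

  ∑-tail-irrelevant : ∀ m n {f : ℕ → Carrier} →
                      (∀ i → m ≤ i → f i ≈ 0#) → (∀ i → n ≤ i → f i ≈ 0#) → ∑ m f ≈ ∑ n f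
  ∑-tail-irrelevant m n f≈0ₘ f≈0ₙ =
    trans (sym (∑-extend (m ℕ.+ n) (ℕP.m≤m+n m n) f≈0ₘ)) (∑-extend (m ℕ.+ n) (ℕP.m≤n+m n m) f≈0ₙ)

  ∑-comm : ∀ m n (f : ℕ → ℕ → Carrier) → ∑[ i < m ] (∑[ j < n ] f i j) ≈ ∑[ j < n ] (∑[ i < m ] f i j)
  ∑-comm zero    n f = sym (∑-zero n (λ _ _ → refl))
  ∑-comm (suc m) n f = begin
    ∑[ i < m ] (∑[ j < n ] f i j) + ∑[ j < n ] f m j   ≈⟨ +-congʳ (∑-comm m n f) ⟩
    ∑[ j < n ] (∑[ i < m ] f i j) + ∑[ j < n ] f m j   ≈⟨ ∑-distrib-+ n _ _ ⟨
    ∑[ j < n ] (∑[ i < m ] f i j + f m j)            ∎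

module UmbralCalculus {c ℓ : Level} (F : Field c ℓ) where
  open Field F hiding (zero)
  open Umbral F
  open import Algebra.Properties.Ring ring using (-0#≈0#; -1*x≈-x; -‿involutive)
  open import Algebra.Properties.Group +-group using (x∙y⁻¹≈ε⇒x≈y; x≈y⇒x∙y⁻¹≈ε; identityʳ-unique)
  open import Algebra.Properties.Semiring.Exp semiring using (_^_)
  open CommutativeRingSolver commutativeRing
  open FiniteSums commutativeRing

  module ≈-Reasoning = Relation.Binary.Reasoning.Setoid setoid

  -- Wrapping _≈ₚ_ (a function type) in a record lets Agda infer both polynomials from a proof.
  infix 4 _≋_
  record _≋_ (p q : Poly) : Set ℓ where
    constructor ≈ₚ⇒≋
    field ≋⇒≈ₚ : p ≈ₚ q
  open _≋_ public

  ≋-isEquivalence : IsEquivalence _≋_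
  ≋-isEquivalence = record
    { refl  = ≈ₚ⇒≋ (λ _ → refl)
    ; sym   = λ p≋q → ≈ₚ⇒≋ (λ n → sym (≋⇒≈ₚ p≋q n))
    ; trans = λ p≋q q≋r → ≈ₚ⇒≋ (λ n → trans (≋⇒≈ₚ p≋q n) (≋⇒≈ₚ q≋r n))
    }

  open IsEquivalence ≋-isEquivalence public
    using () renaming (refl to ≋-refl; sym to ≋-sym; trans to ≋-trans)

  ≋-setoid : Setoid c ℓ
  ≋-setoid = record { isEquivalence = ≋-isEquivalence }

  module ≋-Reasoning = Relation.Binary.Reasoning.Setoid ≋-setoid

  coeff-+ₚ : ∀ p q n → coeff (p +ₚ q) n ≈ coeff p n + coeff q n
  coeff-+ₚ []      q       n       = sym (+-identityˡ _)
  coeff-+ₚ (a ∷ p) []      n       = sym (+-identityʳ _)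
  coeff-+ₚ (a ∷ p) (b ∷ q) zero    = refl
  coeff-+ₚ (a ∷ p) (b ∷ q) (suc n) = coeff-+ₚ p q n

  coeff-scale : ∀ k p n → coeff (scale k p) n ≈ k * coeff p n
  coeff-scale k []      n       = sym (zeroʳ k)
  coeff-scale k (a ∷ p) zero    = refl
  coeff-scale k (a ∷ p) (suc n) = coeff-scale k p n

  coeff--ₚ : ∀ p q n → coeff (p -ₚ q) n ≈ coeff p n - coeff q n
  coeff--ₚ p q n = trans (coeff-+ₚ p _ n) (+-congˡ (trans (coeff-scale (- 1#) q n) (-1*x≈-x _)))

  coeff-sumₚ : ∀ n f m → coeff (sumₚ n f) m ≈ ∑[ k < n ] coeff (f k) m
  coeff-sumₚ zero    f m = refl
  coeff-sumₚ (suc n) f m = trans (coeff-+ₚ (sumₚ n f) (f n) m) (+-congʳ (coeff-sumₚ n f m))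

  DegreeBelow : ℕ → Poly → Set ℓ
  DegreeBelow n p = ∀ i → n ≤ i → coeff p i ≈ 0#

  degreeBelow-length : ∀ p → DegreeBelow (length p) p
  degreeBelow-length []      i       _           = refl
  degreeBelow-length (a ∷ p) (suc i) (s≤s len≤i) = degreeBelow-length p i len≤i

  degreeBelow-mono : ∀ {m n p} → m ≤ n → DegreeBelow m p → DegreeBelow n p
  degreeBelow-mono m≤n deg<m i n≤i = deg<m i (ℕP.≤-trans m≤n n≤i)

  degreeBelow-0 : ∀ {p} → DegreeBelow 0 p → p ≋ []
  degreeBelow-0 deg<0 = ≈ₚ⇒≋ (λ i → deg<0 i z≤n)

  module LinearOperator {T : Op} (linear : IsLinear T) where

    T-cong : ∀ {p q} → p ≋ q → T p ≋ T q
    T-cong p≋q = ≈ₚ⇒≋ (IsLinear.cong linear (≋⇒≈ₚ p≋q))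

    T-+ₚ : ∀ p q → T (p +ₚ q) ≋ T p +ₚ T q
    T-+ₚ p q = ≈ₚ⇒≋ (IsLinear.additive linear p q)

    T-scale : ∀ k p → T (scale k p) ≋ scale k (T p)
    T-scale k p = ≈ₚ⇒≋ (IsLinear.homogeneous linear k p)

    T-zero : ∀ {p} → p ≋ [] → T p ≋ []
    T-zero {p} p≋[] = ≈ₚ⇒≋ λ n → begin
      coeff (T p) n              ≈⟨ ≋⇒≈ₚ (T-cong p≋0p) n ⟩
      coeff (T (scale 0# p)) n   ≈⟨ ≋⇒≈ₚ (T-scale 0# p) n ⟩
      coeff (scale 0# (T p)) n   ≈⟨ coeff-scale 0# (T p) n ⟩
      0# * coeff (T p) n         ≈⟨ zeroˡ _ ⟩
      0#                         ∎
      where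
      open ≈-Reasoning
      p≋0p : p ≋ scale 0# p
      p≋0p = ≈ₚ⇒≋ (λ m → trans (≋⇒≈ₚ p≋[] m) (sym (trans (coeff-scale 0# p m) (zeroˡ _))))

    T-sumₚ : ∀ n f → T (sumₚ n f) ≋ sumₚ n (λ k → T (f k))
    T-sumₚ zero    f = T-zero ≋-refl
    T-sumₚ (suc n) f = ≈ₚ⇒≋ λ m → begin
      coeff (T (sumₚ n f +ₚ f n)) m              ≈⟨ ≋⇒≈ₚ (T-+ₚ (sumₚ n f) (f n)) m ⟩
      coeff (T (sumₚ n f) +ₚ T (f n)) m          ≈⟨ coeff-+ₚ (T (sumₚ n f)) (T (f n)) m ⟩
      coeff (T (sumₚ n f)) m + coeff (T (f n)) m ≈⟨ +-congʳ (≋⇒≈ₚ (T-sumₚ n f) m) ⟩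
      coeff (sumₚ n (λ k → T (f k))) m + coeff (T (f n)) m ≈⟨ coeff-+ₚ (sumₚ n (λ k → T (f k))) (T (f n)) m ⟨
      coeff (sumₚ (suc n) (λ k → T (f k))) m     ∎
      where open ≈-Reasoning

    coeff-T-combination : ∀ n (w : ℕ → Carrier) (f : ℕ → Poly) m →
      coeff (T (sumₚ n (λ k → scale (w k) (f k)))) m ≈ ∑[ k < n ] (w k * coeff (T (f k)) m)
    coeff-T-combination n w f m = begin
      coeff (T (sumₚ n (λ k → scale (w k) (f k)))) m    ≈⟨ ≋⇒≈ₚ (T-sumₚ n _) m ⟩
      coeff (sumₚ n (λ k → T (scale (w k) (f k)))) m    ≈⟨ coeff-sumₚ n _ m ⟩
      ∑[ k < n ] coeff (T (scale (w k) (f k))) m         ≈⟨ ∑-cong n (λ k → ≋⇒≈ₚ (T-scale (w k) (f k)) m) ⟩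
      ∑[ k < n ] coeff (scale (w k) (T (f k))) m         ≈⟨ ∑-cong n (λ k → coeff-scale (w k) (T (f k)) m) ⟩
      ∑[ k < n ] (w k * coeff (T (f k)) m)               ∎
      where open ≈-Reasoning

    ^-cong : ∀ k {p q} → p ≋ q → (T ^ₒ k) p ≋ (T ^ₒ k) q
    ^-cong zero    p≋q = p≋q
    ^-cong (suc k) p≋q = T-cong (^-cong k p≋q)

    ^-suc : ∀ k p → (T ^ₒ k) (T p) ≋ (T ^ₒ suc k) p
    ^-suc zero    p = ≋-refl
    ^-suc (suc k) p = T-cong (^-suc k p)

    ^-shift : ShiftInvariant T → ∀ k a p → (T ^ₒ k) (E a p) ≋ E a ((T ^ₒ k) p)
    ^-shift invariant zero    a p = ≋-refl
    ^-shift invariant (suc k) a p =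
      ≋-trans (T-cong (^-shift invariant k a p)) (≈ₚ⇒≋ (invariant a ((T ^ₒ k) p)))

    ^-suc-shift : ShiftInvariant T → ∀ {h f} a → T h ≋ E a f → ∀ k → (T ^ₒ suc k) h ≋ E a ((T ^ₒ k) f)
    ^-suc-shift invariant {h} {f} a Th≋Eᵃf k =
      ≋-trans (≋-sym (^-suc k h)) (≋-trans (^-cong k Th≋Eᵃf) (^-shift invariant k a f))

  eval-constant : ∀ a b → eval a (b ∷ []) ≈ b
  eval-constant a b = trans (+-congˡ (zeroʳ a)) (+-identityʳ b)

  eval-≈ₚ : ∀ a p q → p ≈ₚ q → eval a p ≈ eval a q
  eval-≈ₚ a []      []      p≈q = refl
  eval-≈ₚ a []      (b ∷ q) p≈q =
    trans (sym (eval-constant a 0#)) (+-cong (p≈q 0) (*-congˡ (eval-≈ₚ a [] q (λ n → p≈q (suc n)))))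
  eval-≈ₚ a (b ∷ p) []      p≈q =
    trans (+-cong (p≈q 0) (*-congˡ (eval-≈ₚ a p [] (λ n → p≈q (suc n))))) (eval-constant a 0#)
  eval-≈ₚ a (b ∷ p) (d ∷ q) p≈q = +-cong (p≈q 0) (*-congˡ (eval-≈ₚ a p q (λ n → p≈q (suc n))))

  eval-cong : ∀ {a p q} → p ≋ q → eval a p ≈ eval a q
  eval-cong {a} {p} {q} p≋q = eval-≈ₚ a p q (≋⇒≈ₚ p≋q)

  eval-cong-point : ∀ {a b} p → a ≈ b → eval a p ≈ eval b p
  eval-cong-point []      a≈b = refl
  eval-cong-point (d ∷ p) a≈b = +-congˡ (*-cong a≈b (eval-cong-point p a≈b))

  eval-difference-≋[] : ∀ x y {p} → p ≋ [] → eval x p - eval y p ≈ 0#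
  eval-difference-≋[] x y p≋[] = trans (+-cong (eval-cong p≋[]) (-‿cong (eval-cong p≋[]))) (-‿inverseʳ 0#)

  eval-+ₚ : ∀ a p q → eval a (p +ₚ q) ≈ eval a p + eval a q
  eval-+ₚ a []      q       = sym (+-identityˡ _)
  eval-+ₚ a (b ∷ p) []      = sym (+-identityʳ _)
  eval-+ₚ a (b ∷ p) (d ∷ q) = begin
    (b + d) + a * eval a (p +ₚ q)                ≈⟨ +-congˡ (*-congˡ (eval-+ₚ a p q)) ⟩
    (b + d) + a * (eval a p + eval a q)          ≈⟨ solve 5 (λ b d a x y → (b :+ d) :+ a :* (x :+ y) := (b :+ a :* x) :+ (d :+ a :* y)) refl b d a _ _ ⟩
    (b + a * eval a p) + (d + a * eval a q)      ∎
    where open ≈-Reasoning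

  eval-scale : ∀ a k p → eval a (scale k p) ≈ k * eval a p
  eval-scale a k []      = sym (zeroʳ k)
  eval-scale a k (b ∷ p) = begin
    k * b + a * eval a (scale k p)   ≈⟨ +-congˡ (*-congˡ (eval-scale a k p)) ⟩
    k * b + a * (k * eval a p)       ≈⟨ solve 4 (λ a k b x → k :* b :+ a :* (k :* x) := k :* (b :+ a :* x)) refl a k b _ ⟩
    k * (b + a * eval a p)           ∎
    where open ≈-Reasoning

  eval--ₚ : ∀ a p q → eval a (p -ₚ q) ≈ eval a p - eval a q
  eval--ₚ a p q = trans (eval-+ₚ a p _) (+-congˡ (trans (eval-scale a (- 1#) q) (-1*x≈-x _)))

  eval-*ₚ : ∀ a p q → eval a (p *ₚ q) ≈ eval a p * eval a q
  eval-*ₚ a []      q = sym (zeroˡ _)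
  eval-*ₚ a (b ∷ p) q = begin
    eval a (scale b q +ₚ (0# ∷ p *ₚ q))               ≈⟨ eval-+ₚ a (scale b q) _ ⟩
    eval a (scale b q) + (0# + a * eval a (p *ₚ q))   ≈⟨ +-cong (eval-scale a b q) (+-congˡ (*-congˡ (eval-*ₚ a p q))) ⟩
    b * eval a q + (0# + a * (eval a p * eval a q))   ≈⟨ solve 4 (λ a b x y → b :* y :+ (con (+ 0) :+ a :* (x :* y)) := (b :+ a :* x) :* y) refl a b _ _ ⟩
    (b + a * eval a p) * eval a q                     ∎
    where open ≈-Reasoning

  eval-sumₚ : ∀ a n f → eval a (sumₚ n f) ≈ ∑[ k < n ] eval a (f k)
  eval-sumₚ a zero    f = refl
  eval-sumₚ a (suc n) f = trans (eval-+ₚ a (sumₚ n f) (f n)) (+-congʳ (eval-sumₚ a n f))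

  eval-E : ∀ b a p → eval b (E a p) ≈ eval (b + a) p
  eval-E b a []      = refl
  eval-E b a (d ∷ p) = begin
    eval b ((d ∷ []) +ₚ (a ∷ 1# ∷ []) *ₚ E a p)                  ≈⟨ eval-+ₚ b (d ∷ []) ((a ∷ 1# ∷ []) *ₚ E a p) ⟩
    eval b (d ∷ []) + eval b ((a ∷ 1# ∷ []) *ₚ E a p)            ≈⟨ +-congˡ (eval-*ₚ b (a ∷ 1# ∷ []) (E a p)) ⟩
    eval b (d ∷ []) + eval b (a ∷ 1# ∷ []) * eval b (E a p)      ≈⟨ +-congˡ (*-congˡ (eval-E b a p)) ⟩
    (d + b * 0#) + (a + b * (1# + b * 0#)) * eval (b + a) p      ≈⟨ solve 4 (λ d a b x → (d :+ b :* con (+ 0)) :+ (a :+ b :* (con (+ 1) :+ b :* con (+ 0))) :* x := d :+ (b :+ a) :* x) refl d a b _ ⟩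
    d + (b + a) * eval (b + a) p                                 ∎
    where open ≈-Reasoning

  eval-id-𝓔 : ∀ a b p → eval a ((idₒ -ₒ 𝓔 b) p) ≈ eval a p - eval b p
  eval-id-𝓔 a b p = trans (eval--ₚ a p (𝓔 b p)) (+-congˡ (-‿cong (eval-constant a (eval b p))))

  eval-sumₚ-id-𝓔 : ∀ b a n (w : ℕ → Carrier) (p : ℕ → Poly) →
    eval b (sumₚ n (λ j → scale (w j) ((idₒ -ₒ 𝓔 a) (p j)))) ≈ ∑[ j < n ] (w j * (eval b (p j) - eval a (p j)))
  eval-sumₚ-id-𝓔 b a n w p = trans (eval-sumₚ b n _)
    (∑-cong n (λ j → trans (eval-scale b (w j) ((idₒ -ₒ 𝓔 a) (p j))) (*-congˡ (eval-id-𝓔 b a (p j)))))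

  x*y≈0⇒y≈0 : ∀ {x y} → ¬ (x ≈ 0#) → x * y ≈ 0# → y ≈ 0#
  x*y≈0⇒y≈0 {x} {y} x≉0 xy≈0 with inverse x x≉0
  ... | x⁻¹ , xx⁻¹≈1 = begin
    y                ≈⟨ *-identityˡ y ⟨
    1# * y           ≈⟨ *-congʳ xx⁻¹≈1 ⟨
    (x * x⁻¹) * y    ≈⟨ solve 3 (λ x x⁻¹ y → (x :* x⁻¹) :* y := x⁻¹ :* (x :* y)) refl x x⁻¹ y ⟩
    x⁻¹ * (x * y)    ≈⟨ *-congˡ xy≈0 ⟩
    x⁻¹ * 0#         ≈⟨ zeroʳ x⁻¹ ⟩
    0#               ∎
    where open ≈-Reasoning

  fromℕ-+ : ∀ m n → fromℕ (m ℕ.+ n) ≈ fromℕ m + fromℕ n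
  fromℕ-+ zero    n = sym (+-identityˡ _)
  fromℕ-+ (suc m) n = trans (+-congˡ (fromℕ-+ m n)) (sym (+-assoc 1# _ _))

  fromℕ-distinct : CharZero → ∀ {i n} → i < n → ¬ (fromℕ i - fromℕ n ≈ 0#)
  fromℕ-distinct char0 {i} {n} i<n i-n≈0 = char0 d (begin
    fromℕ (suc d)                              ≈⟨ solve 2 (λ x y → y := :- (x :- (x :+ y))) refl (fromℕ i) (fromℕ (suc d)) ⟩
    - (fromℕ i - (fromℕ i + fromℕ (suc d)))    ≈⟨ -‿cong (+-congˡ (-‿cong (fromℕ-+ i (suc d)))) ⟨
    - (fromℕ i - fromℕ (i ℕ.+ suc d))          ≡⟨ ≡.cong (λ k → - (fromℕ i - fromℕ k)) i+[1+d]≡n ⟩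
    - (fromℕ i - fromℕ n)                      ≈⟨ -‿cong i-n≈0 ⟩
    - 0#                                       ≈⟨ -0#≈0# ⟩
    0#                                         ∎)
    where
    open ≈-Reasoning
    d = n ℕ.∸ suc i
    i+[1+d]≡n : i ℕ.+ suc d ≡ n
    i+[1+d]≡n = ≡.trans (ℕP.+-suc i d) (ℕP.m+[n∸m]≡n i<n)

  syntheticQuotient : Carrier → Poly → Poly
  syntheticQuotient r []          = []
  syntheticQuotient r (b ∷ [])    = []
  syntheticQuotient r (b ∷ d ∷ p) = eval r (d ∷ p) ∷ syntheticQuotient r (d ∷ p)

  length-syntheticQuotient : ∀ r p {n} → length p ≤ suc n → length (syntheticQuotient r p) ≤ n
  length-syntheticQuotient r []          _   = z≤n
  length-syntheticQuotient r (b ∷ [])    _   = z≤n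
  length-syntheticQuotient r (b ∷ d ∷ p) {suc n} (s≤s len≤1+n) = s≤s (length-syntheticQuotient r (d ∷ p) len≤1+n)

  eval-syntheticQuotient : ∀ a r p → eval a p ≈ (a - r) * eval a (syntheticQuotient r p) + eval r p
  eval-syntheticQuotient a r []          = solve 2 (λ a r → con (+ 0) := (a :- r) :* con (+ 0) :+ con (+ 0)) refl a r
  eval-syntheticQuotient a r (b ∷ [])    = solve 3 (λ a r b → b :+ a :* con (+ 0) := (a :- r) :* con (+ 0) :+ (b :+ r :* con (+ 0))) refl a r b
  eval-syntheticQuotient a r (b ∷ d ∷ p) = begin
    b + a * eval a (d ∷ p)                                         ≈⟨ +-congˡ (*-congˡ (eval-syntheticQuotient a r (d ∷ p))) ⟩
    b + a * ((a - r) * eval a q + eval r (d ∷ p))                  ≈⟨ solve 5 (λ a r b x y → b :+ a :* ((a :- r) :* y :+ x) := (a :- r) :* (x :+ a :* y) :+ (b :+ r :* x)) refl a r b _ _ ⟩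
    (a - r) * (eval r (d ∷ p) + a * eval a q) + (b + r * eval r (d ∷ p)) ∎
    where
    open ≈-Reasoning
    q = syntheticQuotient r (d ∷ p)

  ∷-≋[] : ∀ {b p} → b ≈ 0# → p ≋ [] → b ∷ p ≋ []
  ∷-≋[] b≈0 p≋[] = ≈ₚ⇒≋ λ { zero → b≈0 ; (suc n) → ≋⇒≈ₚ p≋[] n }

  syntheticQuotient-≋[] : ∀ r p → eval r p ≈ 0# → syntheticQuotient r p ≋ [] → p ≋ []
  syntheticQuotient-≋[] r []          _     _    = ≋-refl
  syntheticQuotient-≋[] r (b ∷ [])    pr≈0  _    = ∷-≋[] (trans (sym (eval-constant r b)) pr≈0) ≋-refl
  syntheticQuotient-≋[] r (b ∷ d ∷ p) pr≈0  q≋[] =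
    ∷-≋[] b≈0 (syntheticQuotient-≋[] r (d ∷ p) p′r≈0 (≈ₚ⇒≋ (λ n → ≋⇒≈ₚ q≋[] (suc n))))
    where
    open ≈-Reasoning
    p′r≈0 : eval r (d ∷ p) ≈ 0#
    p′r≈0 = ≋⇒≈ₚ q≋[] 0
    b≈0 : b ≈ 0#
    b≈0 = begin
      b                                          ≈⟨ solve 3 (λ b r x → b := (b :+ r :* x) :- r :* x) refl b r _ ⟩
      (b + r * eval r (d ∷ p)) - r * eval r (d ∷ p) ≈⟨ +-cong pr≈0 (-‿cong (*-congˡ p′r≈0)) ⟩
      0# - r * 0#                                ≈⟨ solve 1 (λ r → con (+ 0) :- r :* con (+ 0) := con (+ 0)) refl r ⟩
      0#                                         ∎

  fromCoeffs : ℕ → (ℕ → Carrier) → Poly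
  fromCoeffs zero    u = []
  fromCoeffs (suc n) u = u 0 ∷ fromCoeffs n (λ k → u (suc k))

  coeff-fromCoeffs : ∀ n u {k} → k < n → coeff (fromCoeffs n u) k ≈ u k
  coeff-fromCoeffs (suc n) u {zero}  _         = refl
  coeff-fromCoeffs (suc n) u {suc k} (s≤s k<n) = coeff-fromCoeffs n (λ k → u (suc k)) k<n

  eval-fromCoeffs : ∀ a n u → eval a (fromCoeffs n u) ≈ ∑[ k < n ] (u k * a ^ k)
  eval-fromCoeffs a zero    u = refl
  eval-fromCoeffs a (suc n) u = begin
    u 0 + a * eval a (fromCoeffs n (λ k → u (suc k)))    ≈⟨ +-congˡ (*-congˡ (eval-fromCoeffs a n (λ k → u (suc k)))) ⟩
    u 0 + a * ∑[ k < n ] (u (suc k) * a ^ k)             ≈⟨ +-cong (sym (*-identityʳ (u 0))) (*-distribˡ-∑ n a _) ⟩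
    u 0 * 1# + ∑[ k < n ] (a * (u (suc k) * a ^ k))      ≈⟨ +-congˡ (∑-cong n (λ k → solve 3 (λ a x y → a :* (x :* y) := x :* (a :* y)) refl a (u (suc k)) (a ^ k))) ⟩
    u 0 * 1# + ∑[ k < n ] (u (suc k) * a ^ suc k)        ≈⟨ ∑-suc n (λ k → u k * a ^ k) ⟨
    ∑[ k < suc n ] (u k * a ^ k)                         ∎
    where open ≈-Reasoning

  -- binomial j k is the image of the binomial coefficient (j + k choose k), by Pascal's rule.
  binomial : ℕ → ℕ → Carrier
  binomial zero    k       = 1#
  binomial (suc j) zero    = 1#
  binomial (suc j) (suc k) = binomial j (suc k) + binomial (suc j) k

  binomial-0 : ∀ j → binomial j 0 ≈ 1#
  binomial-0 zero    = refl
  binomial-0 (suc j) = refl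

  binomial-sym : ∀ j k → binomial j k ≈ binomial k j
  binomial-sym zero    zero    = refl
  binomial-sym zero    (suc k) = refl
  binomial-sym (suc j) zero    = refl
  binomial-sym (suc j) (suc k) = trans (+-cong (binomial-sym j (suc k)) (binomial-sym (suc j) k)) (+-comm _ _)

  -- The Hasse derivative Dᵏ p / k!, computed without division from
  -- H₀ (b + x p) = b + x H₀ p  and  Hₖ₊₁ (b + x p) = x Hₖ₊₁ p + Hₖ p.
  hasse : Poly → ℕ → Poly
  hasse []      k       = []
  hasse (b ∷ p) zero    = b ∷ hasse p zero
  hasse (b ∷ p) (suc k) = (0# ∷ hasse p (suc k)) +ₚ hasse p k

  coeff-hasse : ∀ p k j → coeff (hasse p k) j ≈ binomial j k * coeff p (j ℕ.+ k)
  coeff-hasse []      k       j       = sym (zeroʳ _)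
  coeff-hasse (b ∷ p) zero    zero    = sym (*-identityˡ b)
  coeff-hasse (b ∷ p) zero    (suc j) = trans (coeff-hasse p zero j) (*-congʳ (binomial-0 j))
  coeff-hasse (b ∷ p) (suc k) zero    = begin
    coeff ((0# ∷ hasse p (suc k)) +ₚ hasse p k) 0   ≈⟨ coeff-+ₚ (0# ∷ hasse p (suc k)) (hasse p k) 0 ⟩
    0# + coeff (hasse p k) 0                        ≈⟨ +-identityˡ _ ⟩
    coeff (hasse p k) 0                             ≈⟨ coeff-hasse p k 0 ⟩
    1# * coeff p k                                  ∎
    where open ≈-Reasoning
  coeff-hasse (b ∷ p) (suc k) (suc j) = begin
    coeff ((0# ∷ hasse p (suc k)) +ₚ hasse p k) (suc j)                 ≈⟨ coeff-+ₚ (0# ∷ hasse p (suc k)) (hasse p k) (suc j) ⟩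
    coeff (hasse p (suc k)) j + coeff (hasse p k) (suc j)               ≈⟨ +-cong (coeff-hasse p (suc k) j) (coeff-hasse p k (suc j)) ⟩
    binomial j (suc k) * coeff p (j ℕ.+ suc k) + binomial (suc j) k * coeff p (suc j ℕ.+ k)
      ≡⟨ ≡.cong (λ n → binomial j (suc k) * coeff p n + binomial (suc j) k * coeff p (suc j ℕ.+ k)) (ℕP.+-suc j k) ⟩
    binomial j (suc k) * coeff p (suc j ℕ.+ k) + binomial (suc j) k * coeff p (suc j ℕ.+ k)
      ≈⟨ distribʳ _ _ _ ⟨
    binomial (suc j) (suc k) * coeff p (suc j ℕ.+ k)                    ≡⟨ ≡.cong (λ n → binomial (suc j) (suc k) * coeff p n) (ℕP.+-suc j k) ⟨
    binomial (suc j) (suc k) * coeff p (j ℕ.+ suc k)                    ∎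
    where open ≈-Reasoning

  hasse-sym : ∀ p i j → coeff (hasse p i) j ≈ coeff (hasse p j) i
  hasse-sym p i j = begin
    coeff (hasse p i) j                ≈⟨ coeff-hasse p i j ⟩
    binomial j i * coeff p (j ℕ.+ i)   ≈⟨ *-cong (binomial-sym j i) (reflexive (≡.cong (coeff p) (ℕP.+-comm j i))) ⟩
    binomial i j * coeff p (i ℕ.+ j)   ≈⟨ coeff-hasse p j i ⟨
    coeff (hasse p j) i                ∎
    where open ≈-Reasoning

  hasse-cong : ∀ {p q} k → p ≋ q → hasse p k ≋ hasse q k
  hasse-cong {p} {q} k p≋q = ≈ₚ⇒≋ λ j →
    trans (coeff-hasse p k j) (trans (*-congˡ (≋⇒≈ₚ p≋q (j ℕ.+ k))) (sym (coeff-hasse q k j)))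

  hasse-degreeBelow : ∀ {n} p k → DegreeBelow (n ℕ.+ k) p → DegreeBelow n (hasse p k)
  hasse-degreeBelow p k deg<n+k j n≤j =
    trans (coeff-hasse p k j) (trans (*-congˡ (deg<n+k (j ℕ.+ k) (ℕP.+-monoˡ-≤ k n≤j))) (zeroʳ _))

  hasse-beyond-length : ∀ p {k} → length p ≤ k → hasse p k ≋ []
  hasse-beyond-length p {k} len≤k =
    degreeBelow-0 (hasse-degreeBelow p k (degreeBelow-mono {p = p} len≤k (degreeBelow-length p)))

  -- Splitting off k = 0, the recursion for hasse turns the sum for d ∷ p into d + (b + a) · (the sum for p).
  eval-taylor : ∀ a b p → ∑[ k < length p ] (a ^ k * eval b (hasse p k)) ≈ eval (b + a) p
  eval-taylor a b []      = refl
  eval-taylor a b (d ∷ p) = begin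
    ∑[ k < suc n ] (a ^ k * eval b (hasse (d ∷ p) k))                            ≈⟨ ∑-suc n _ ⟩
    1# * eval b (d ∷ hasse p 0) + ∑[ k < n ] (a ^ suc k * eval b ((0# ∷ hasse p (suc k)) +ₚ hasse p k))
      ≈⟨ +-congˡ (∑-cong n (λ k → *-congˡ (eval-+ₚ b (0# ∷ hasse p (suc k)) (hasse p k)))) ⟩
    1# * (d + b * eval b (hasse p 0)) + ∑[ k < n ] (a ^ suc k * ((0# + b * eval b (hasse p (suc k))) + eval b (hasse p k)))
      ≈⟨ +-congˡ (∑-cong n (λ k → solve 5 (λ a w b y z → (a :* w) :* ((con (+ 0) :+ b :* y) :+ z) := b :* ((a :* w) :* y) :+ a :* (w :* z)) refl a (a ^ k) b _ _)) ⟩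
    1# * (d + b * eval b (hasse p 0)) + ∑[ k < n ] (b * (a ^ suc k * eval b (hasse p (suc k))) + a * (a ^ k * eval b (hasse p k)))
      ≈⟨ +-congˡ (∑-distrib-+ n _ _) ⟩
    1# * (d + b * eval b (hasse p 0)) + (∑[ k < n ] (b * (a ^ suc k * eval b (hasse p (suc k)))) + ∑[ k < n ] (a * (a ^ k * eval b (hasse p k))))
      ≈⟨ +-congˡ (+-cong (*-distribˡ-∑ n b _) (*-distribˡ-∑ n a _)) ⟨
    1# * (d + b * eval b (hasse p 0)) + (b * ∑[ k < n ] (a ^ suc k * eval b (hasse p (suc k))) + a * S)
      ≈⟨ solve 6 (λ d b e₀ s a S → con (+ 1) :* (d :+ b :* e₀) :+ (b :* s :+ a :* S) := d :+ b :* (con (+ 1) :* e₀ :+ s) :+ a :* S) refl d b _ _ a S ⟩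
    d + b * (1# * eval b (hasse p 0) + ∑[ k < n ] (a ^ suc k * eval b (hasse p (suc k)))) + a * S
      ≈⟨ +-congʳ (+-congˡ (*-congˡ (∑-suc n (λ k → a ^ k * eval b (hasse p k))))) ⟨
    d + b * ∑[ k < suc n ] (a ^ k * eval b (hasse p k)) + a * S
      ≈⟨ +-congʳ (+-congˡ (*-congˡ (trans (+-congˡ (*-congˡ (eval-cong (hasse-beyond-length p ℕP.≤-refl)))) (trans (+-congˡ (zeroʳ _)) (+-identityʳ S))))) ⟩
    d + b * S + a * S                                     ≈⟨ solve 4 (λ d b a S → d :+ b :* S :+ a :* S := d :+ (b :+ a) :* S) refl d b a S ⟩
    d + (b + a) * S                                       ≈⟨ +-congˡ (*-congˡ (eval-taylor a b p)) ⟩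
    d + (b + a) * eval (b + a) p                          ∎
    where
    open ≈-Reasoning
    n = length p
    S = ∑[ k < n ] (a ^ k * eval b (hasse p k))

  monomial : ℕ → Poly
  monomial zero    = 1# ∷ []
  monomial (suc i) = 0# ∷ monomial i

  coeff-monomial-≡ : ∀ i → coeff (monomial i) i ≈ 1#
  coeff-monomial-≡ zero    = refl
  coeff-monomial-≡ (suc i) = coeff-monomial-≡ i

  coeff-monomial-≢ : ∀ {i j} → i ≢ j → coeff (monomial i) j ≈ 0#
  coeff-monomial-≢ {zero}  {zero}  0≢0   = contradiction ≡.refl 0≢0
  coeff-monomial-≢ {zero}  {suc j} _     = refl
  coeff-monomial-≢ {suc i} {zero}  _     = refl
  coeff-monomial-≢ {suc i} {suc j} 1+i≢1+j = coeff-monomial-≢ (λ i≡j → 1+i≢1+j (≡.cong suc i≡j))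

  ∑-monomial-beyond : ∀ n (f : ℕ → Carrier) {j} → n ≤ j → ∑[ i < n ] (f i * coeff (monomial i) j) ≈ 0#
  ∑-monomial-beyond n f n≤j = ∑-zero n λ i i<n →
    trans (*-congˡ (coeff-monomial-≢ (λ i≡j → ℕP.<-irrefl i≡j (ℕP.<-≤-trans i<n n≤j)))) (zeroʳ _)

  ∑-monomial : ∀ n (f : ℕ → Carrier) {j} → j < n → ∑[ i < n ] (f i * coeff (monomial i) j) ≈ f j
  ∑-monomial (suc n) f {j} (s≤s j≤n) with ℕP.m≤n⇒m<n∨m≡n j≤n
  ... | inj₁ j<n   = begin
    ∑[ i < n ] (f i * coeff (monomial i) j) + f n * coeff (monomial n) j   ≈⟨ +-cong (∑-monomial n f j<n) (*-congˡ (coeff-monomial-≢ (λ n≡j → ℕP.<-irrefl (≡.sym n≡j) j<n))) ⟩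
    f j + f n * 0#                                                       ≈⟨ trans (+-congˡ (zeroʳ _)) (+-identityʳ _) ⟩
    f j                                                                  ∎
    where open ≈-Reasoning
  ... | inj₂ ≡.refl = begin
    ∑[ i < j ] (f i * coeff (monomial i) j) + f j * coeff (monomial j) j   ≈⟨ +-cong (∑-monomial-beyond j f ℕP.≤-refl) (*-congˡ (coeff-monomial-≡ j)) ⟩
    0# + f j * 1#                                                        ≈⟨ trans (+-identityˡ _) (*-identityʳ _) ⟩
    f j                                                                  ∎
    where open ≈-Reasoning

  monomial-expansion : ∀ {n q} → DegreeBelow n q → q ≋ sumₚ n (λ i → scale (coeff q i) (monomial i))
  monomial-expansion {n} {q} deg<n = ≈ₚ⇒≋ λ j → sym (begin
    coeff (sumₚ n (λ i → scale (coeff q i) (monomial i))) j    ≈⟨ coeff-sumₚ n _ j ⟩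
    ∑[ i < n ] coeff (scale (coeff q i) (monomial i)) j         ≈⟨ ∑-cong n (λ i → coeff-scale (coeff q i) (monomial i) j) ⟩
    ∑[ i < n ] (coeff q i * coeff (monomial i) j)               ≈⟨ kronecker j ⟩
    coeff q j                                                   ∎)
    where
    open ≈-Reasoning
    kronecker : ∀ j → ∑[ i < n ] (coeff q i * coeff (monomial i) j) ≈ coeff q j
    kronecker j with ℕP.<-≤-connex j n
    ... | inj₁ j<n = ∑-monomial n (coeff q) j<n
    ... | inj₂ n≤j = trans (∑-monomial-beyond n (coeff q) n≤j) (sym (deg<n j n≤j))

  coeff-D : ∀ p j → coeff (D p) j ≈ fromℕ (suc j) * coeff p (suc j)
  coeff-D []      j       = sym (zeroʳ _)
  coeff-D (b ∷ p) zero    = trans (coeff-+ₚ p (0# ∷ D p) 0) (trans (+-identityʳ _) (sym (trans (*-congʳ (+-identityʳ 1#)) (*-identityˡ _))))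
  coeff-D (b ∷ p) (suc j) = trans (coeff-+ₚ p (0# ∷ D p) (suc j))
    (trans (+-congˡ (coeff-D p j)) (trans (+-congʳ (sym (*-identityˡ _))) (sym (distribʳ _ _ _))))

  D-cong : ∀ {p q} → p ≋ q → D p ≋ D q
  D-cong {p} {q} p≋q = ≈ₚ⇒≋ λ j →
    trans (coeff-D p j) (trans (*-congˡ (≋⇒≈ₚ p≋q (suc j))) (sym (coeff-D q j)))

  constantTerm : Op → Poly → Carrier
  constantTerm T q = coeff (T q) 0

  -- A shift-invariant T is ∑ᵢ expansionCoeff T i · Dⁱ/i!  (coeff-expansion below).
  expansionCoeff : Op → ℕ → Carrier
  expansionCoeff T i = constantTerm T (monomial i)

  -- The constant term of A (B q) in terms of the expansion coefficients of A and B
  -- (constantTerm-∘); its symmetry is why shift-invariant operators commute.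
  umbralPairing : (ℕ → Carrier) → (ℕ → Carrier) → Poly → Carrier
  umbralPairing s t q = ∑[ i < length q ] (∑[ j < length q ] (s i * t j * coeff (hasse q j) i))

  umbralPairing-sym : ∀ s t q → umbralPairing s t q ≈ umbralPairing t s q
  umbralPairing-sym s t q = begin
    ∑[ i < n ] (∑[ j < n ] (s i * t j * coeff (hasse q j) i))   ≈⟨ ∑-cong n (λ i → ∑-cong n (λ j → *-cong (*-comm (s i) (t j)) (hasse-sym q j i))) ⟩
    ∑[ i < n ] (∑[ j < n ] (t j * s i * coeff (hasse q i) j))   ≈⟨ ∑-comm n n _ ⟩
    ∑[ j < n ] (∑[ i < n ] (t j * s i * coeff (hasse q i) j))   ∎
    where
    open ≈-Reasoning
    n = length q

  sigma-vanishes-at-0 : ∀ {Q Q⁻¹} → IsSigma Q Q⁻¹ → ∀ g → eval 0# (Q⁻¹ g) ≈ 0#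
  sigma-vanishes-at-0 {Q} {Q⁻¹} (linear , QQ⁻¹≈1 , Q⁻¹Q≈1-𝓔₀) g = begin
    eval 0# h           ≈⟨ -‿involutive _ ⟨
    - - eval 0# h       ≈⟨ -‿cong (identityʳ-unique (coeff h 0) _ (begin
                             coeff h 0 - eval 0# h          ≈⟨ coeff--ₚ h (𝓔 0# h) 0 ⟨
                             coeff ((idₒ -ₒ 𝓔 0#) h) 0      ≈⟨ Q⁻¹Q≈1-𝓔₀ h 0 ⟨
                             coeff (Q⁻¹ (Q h)) 0            ≈⟨ ≋⇒≈ₚ (T-cong (≈ₚ⇒≋ (QQ⁻¹≈1 g))) 0 ⟩
                             coeff h 0                      ∎)) ⟩
    - 0#                ≈⟨ -0#≈0# ⟩
    0#                  ∎
    where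
    open ≈-Reasoning
    open LinearOperator linear
    h = Q⁻¹ g

  module _ (char0 : CharZero) where

    vanishing-at-naturals⇒≋[] : ∀ n p → length p ≤ n → (∀ i → i < n → eval (fromℕ i) p ≈ 0#) → p ≋ []
    vanishing-at-naturals⇒≋[] zero    [] _      _      = ≋-refl
    vanishing-at-naturals⇒≋[] (suc n) p  len≤1+n p[i]≈0 =
      syntheticQuotient-≋[] r p (p[i]≈0 n ℕP.≤-refl)
        (vanishing-at-naturals⇒≋[] n q (length-syntheticQuotient r p len≤1+n) q[i]≈0)
      where
      open ≈-Reasoning
      r = fromℕ n
      q = syntheticQuotient r p
      q[i]≈0 : ∀ i → i < n → eval (fromℕ i) q ≈ 0#
      q[i]≈0 i i<n = x*y≈0⇒y≈0 (fromℕ-distinct char0 i<n) (begin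
        (fromℕ i - r) * eval (fromℕ i) q                 ≈⟨ +-identityʳ _ ⟨
        (fromℕ i - r) * eval (fromℕ i) q + 0#            ≈⟨ +-congˡ (p[i]≈0 n ℕP.≤-refl) ⟨
        (fromℕ i - r) * eval (fromℕ i) q + eval r p      ≈⟨ eval-syntheticQuotient (fromℕ i) r p ⟨
        eval (fromℕ i) p                                 ≈⟨ p[i]≈0 i (ℕP.m<n⇒m<1+n i<n) ⟩
        0#                                               ∎)

    eval-injective : ∀ p q → (∀ a → eval a p ≈ eval a q) → p ≋ q
    eval-injective p q p[a]≈q[a] =
      ≈ₚ⇒≋ (λ n → x∙y⁻¹≈ε⇒x≈y _ _ (trans (sym (coeff--ₚ p q n)) (≋⇒≈ₚ p-q≋[] n)))
      where
      p-q≋[] : p -ₚ q ≋ []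
      p-q≋[] = vanishing-at-naturals⇒≋[] _ (p -ₚ q) ℕP.≤-refl
        (λ i _ → trans (eval--ₚ (fromℕ i) p q) (x≈y⇒x∙y⁻¹≈ε (p[a]≈q[a] (fromℕ i))))

    coefficients-unique : ∀ n (u v : ℕ → Carrier) → (∀ a → ∑[ k < n ] (u k * a ^ k) ≈ ∑[ k < n ] (v k * a ^ k)) →
                          ∀ {k} → k < n → u k ≈ v k
    coefficients-unique n u v u[a]≈v[a] {k} k<n = begin
      u k                        ≈⟨ coeff-fromCoeffs n u k<n ⟨
      coeff (fromCoeffs n u) k   ≈⟨ ≋⇒≈ₚ (eval-injective (fromCoeffs n u) (fromCoeffs n v) same-values) k ⟩
      coeff (fromCoeffs n v) k   ≈⟨ coeff-fromCoeffs n v k<n ⟩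
      v k                        ∎
      where
      open ≈-Reasoning
      same-values : ∀ a → eval a (fromCoeffs n u) ≈ eval a (fromCoeffs n v)
      same-values a = trans (eval-fromCoeffs a n u) (trans (u[a]≈v[a] a) (sym (eval-fromCoeffs a n v)))

    taylor : ∀ a p {n} → length p ≤ n → E a p ≋ sumₚ n (λ k → scale (a ^ k) (hasse p k))
    taylor a p {n} len≤n = eval-injective (E a p) (sumₚ n (λ k → scale (a ^ k) (hasse p k))) λ b → begin
      eval b (E a p)                                       ≈⟨ eval-E b a p ⟩
      eval (b + a) p                                       ≈⟨ eval-taylor a b p ⟨
      ∑[ k < length p ] (a ^ k * eval b (hasse p k))       ≈⟨ ∑-extend n len≤n (λ k len≤k → trans (*-congˡ (eval-cong (hasse-beyond-length p len≤k))) (zeroʳ _)) ⟨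
      ∑[ k < n ] (a ^ k * eval b (hasse p k))              ≈⟨ ∑-cong n (λ k → eval-scale b (a ^ k) (hasse p k)) ⟨
      ∑[ k < n ] eval b (scale (a ^ k) (hasse p k))        ≈⟨ eval-sumₚ b n _ ⟨
      eval b (sumₚ n (λ k → scale (a ^ k) (hasse p k)))    ∎
      where open ≈-Reasoning

    module ShiftInvariantOperator {T : Op} (linear : IsLinear T) (invariant : ShiftInvariant T) where
      open LinearOperator linear public

      -- Both sides are the coefficient of aᵏ in T (E a p) = E a (T p), expanded by Taylor's formula.
      T-hasse : ∀ p k → T (hasse p k) ≋ hasse (T p) k
      T-hasse p k = ≈ₚ⇒≋ λ m → coefficients-agree m k
        where
        open ≈-Reasoning
        N = length p ℕ.+ length (T p)
        lhs rhs : ℕ → ℕ → Carrier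
        lhs m k = coeff (T (hasse p k)) m
        rhs m k = coeff (hasse (T p) k) m
        expand-lhs : ∀ a m → coeff (T (E a p)) m ≈ ∑[ k < N ] (lhs m k * a ^ k)
        expand-lhs a m = begin
          coeff (T (E a p)) m                                      ≈⟨ ≋⇒≈ₚ (T-cong (taylor a p (ℕP.m≤m+n _ _))) m ⟩
          coeff (T (sumₚ N (λ k → scale (a ^ k) (hasse p k)))) m   ≈⟨ coeff-T-combination N (a ^_) (hasse p) m ⟩
          ∑[ k < N ] (a ^ k * lhs m k)                             ≈⟨ ∑-cong N (λ k → *-comm _ _) ⟩
          ∑[ k < N ] (lhs m k * a ^ k)                             ∎
        expand-rhs : ∀ a m → coeff (E a (T p)) m ≈ ∑[ k < N ] (rhs m k * a ^ k)
        expand-rhs a m = begin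
          coeff (E a (T p)) m                                      ≈⟨ ≋⇒≈ₚ (taylor a (T p) (ℕP.m≤n+m (length (T p)) (length p))) m ⟩
          coeff (sumₚ N (λ k → scale (a ^ k) (hasse (T p) k))) m   ≈⟨ coeff-sumₚ N _ m ⟩
          ∑[ k < N ] coeff (scale (a ^ k) (hasse (T p) k)) m       ≈⟨ ∑-cong N (λ k → trans (coeff-scale (a ^ k) (hasse (T p) k) m) (*-comm _ _)) ⟩
          ∑[ k < N ] (rhs m k * a ^ k)                             ∎
        coefficients-agree : ∀ m k → lhs m k ≈ rhs m k
        coefficients-agree m k with ℕP.<-≤-connex k N
        ... | inj₁ k<N = coefficients-unique N (lhs m) (rhs m)
                           (λ a → trans (sym (expand-lhs a m)) (trans (invariant a p m) (expand-rhs a m))) k<N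
        ... | inj₂ N≤k = trans (≋⇒≈ₚ (T-zero (hasse-beyond-length p (ℕP.≤-trans (ℕP.m≤m+n _ _) N≤k))) m)
                               (sym (≋⇒≈ₚ (hasse-beyond-length (T p) (ℕP.≤-trans (ℕP.m≤n+m _ _) N≤k)) m))

      coeff≈constantTerm-hasse : ∀ p k → coeff (T p) k ≈ constantTerm T (hasse p k)
      coeff≈constantTerm-hasse p k = begin
        coeff (T p) k             ≈⟨ *-identityˡ _ ⟨
        1# * coeff (T p) k        ≈⟨ coeff-hasse (T p) k 0 ⟨
        coeff (hasse (T p) k) 0   ≈⟨ ≋⇒≈ₚ (T-hasse p k) 0 ⟨
        coeff (T (hasse p k)) 0   ∎
        where open ≈-Reasoning

      constantTerm-expansion : ∀ {n q} → DegreeBelow n q → constantTerm T q ≈ ∑[ i < n ] (coeff q i * expansionCoeff T i)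
      constantTerm-expansion {n} {q} deg<n =
        trans (≋⇒≈ₚ (T-cong (monomial-expansion deg<n)) 0) (coeff-T-combination n (coeff q) monomial 0)

      coeff-expansion : ∀ p k → coeff (T p) k ≈ ∑[ j < length p ] (expansionCoeff T j * coeff (hasse p j) k)
      coeff-expansion p k = begin
        coeff (T p) k                                                ≈⟨ coeff≈constantTerm-hasse p k ⟩
        constantTerm T (hasse p k)                                   ≈⟨ constantTerm-expansion hasse-deg ⟩
        ∑[ j < length p ] (coeff (hasse p k) j * expansionCoeff T j) ≈⟨ ∑-cong (length p) (λ j → trans (*-comm _ _) (*-congˡ (hasse-sym p k j))) ⟩
        ∑[ j < length p ] (expansionCoeff T j * coeff (hasse p j) k) ∎
        where
        open ≈-Reasoning
        hasse-deg : DegreeBelow (length p) (hasse p k)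
        hasse-deg = hasse-degreeBelow p k (degreeBelow-mono {p = p} (ℕP.m≤m+n _ k) (degreeBelow-length p))

      degreeBelow-preserved : ∀ {n} p → DegreeBelow n p → DegreeBelow n (T p)
      degreeBelow-preserved {n} p deg<n k n≤k = trans (coeff-expansion p k) (∑-zero (length p) λ j _ →
        trans (*-congˡ (hasse-degreeBelow p j (degreeBelow-mono {p = p} (ℕP.m≤m+n n j) deg<n) k n≤k)) (zeroʳ _))

    constantTerm-∘ : ∀ {A B} → IsLinear A → ShiftInvariant A → IsLinear B → ShiftInvariant B →
                     ∀ q → constantTerm A (B q) ≈ umbralPairing (expansionCoeff A) (expansionCoeff B) q
    constantTerm-∘ {A} {B} linA invA linB invB q = begin
      constantTerm A (B q)                                            ≈⟨ A′.constantTerm-expansion (B′.degreeBelow-preserved q (degreeBelow-length q)) ⟩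
      ∑[ i < n ] (coeff (B q) i * a i)                                ≈⟨ ∑-cong n (λ i → *-congʳ (B′.coeff-expansion q i)) ⟩
      ∑[ i < n ] (∑[ j < n ] (b j * coeff (hasse q j) i) * a i)       ≈⟨ ∑-cong n (λ i → trans (*-distribʳ-∑ n (a i) _) (∑-cong n (λ j → rearrange (b j) _ (a i)))) ⟩
      umbralPairing a b q                                             ∎
      where
      open ≈-Reasoning
      module A′ = ShiftInvariantOperator linA invA
      module B′ = ShiftInvariantOperator linB invB
      n = length q
      a b : ℕ → Carrier
      a = expansionCoeff A
      b = expansionCoeff B
      rearrange : ∀ x y z → x * y * z ≈ z * x * y
      rearrange = solve 3 (λ x y z → x :* y :* z := z :* x :* y) refl

    shiftInvariant-comm : ∀ {A B} → IsLinear A → ShiftInvariant A → IsLinear B → ShiftInvariant B →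
                          ∀ p → A (B p) ≋ B (A p)
    shiftInvariant-comm {A} {B} linA invA linB invB p = ≈ₚ⇒≋ λ k → begin
      coeff (A (B p)) k                 ≈⟨ A′.coeff≈constantTerm-hasse (B p) k ⟩
      constantTerm A (hasse (B p) k)    ≈⟨ ≋⇒≈ₚ (A′.T-cong (B′.T-hasse p k)) 0 ⟨
      constantTerm A (B (hasse p k))    ≈⟨ constantTerm-∘ linA invA linB invB (hasse p k) ⟩
      umbralPairing a b (hasse p k)     ≈⟨ umbralPairing-sym a b (hasse p k) ⟩
      umbralPairing b a (hasse p k)     ≈⟨ constantTerm-∘ linB invB linA invA (hasse p k) ⟨
      constantTerm B (A (hasse p k))    ≈⟨ ≋⇒≈ₚ (B′.T-cong (A′.T-hasse p k)) 0 ⟩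
      constantTerm B (hasse (A p) k)    ≈⟨ B′.coeff≈constantTerm-hasse (A p) k ⟨
      coeff (B (A p)) k                 ∎
      where
      open ≈-Reasoning
      module A′ = ShiftInvariantOperator linA invA
      module B′ = ShiftInvariantOperator linB invB
      a b : ℕ → Carrier
      a = expansionCoeff A
      b = expansionCoeff B

    module DeltaOperator {Q : Op} (linear : IsLinear Q) (invariant : ShiftInvariant Q)
                         {k : Carrier} (QX≈k : Q X ≈ₚ (k ∷ [])) where
      open ShiftInvariantOperator linear invariant public

      annihilates-constants : Q (monomial 0) ≋ []
      annihilates-constants = begin
        Q (monomial 0)     ≈⟨ T-cong hasse-X-1 ⟨
        Q (hasse X 1)      ≈⟨ T-hasse X 1 ⟩
        hasse (Q X) 1      ≈⟨ hasse-cong {Q X} {k ∷ []} 1 (≈ₚ⇒≋ QX≈k) ⟩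
        hasse (k ∷ []) 1   ≈⟨ hasse-beyond-length (k ∷ []) ℕP.≤-refl ⟩
        []                 ∎
        where
        open ≋-Reasoning
        hasse-X-1 : hasse X 1 ≋ monomial 0
        hasse-X-1 = ≈ₚ⇒≋ λ { zero → +-identityˡ 1# ; (suc zero) → refl ; (suc (suc n)) → refl }

      lowers-degree : ∀ {n} p → DegreeBelow (suc n) p → DegreeBelow n (Q p)
      lowers-degree {n} p deg<1+n i n≤i = trans (coeff-expansion p i) (∑-zero (length p) term≈0)
        where
        term≈0 : ∀ j → j < length p → expansionCoeff Q j * coeff (hasse p j) i ≈ 0#
        term≈0 zero    _ = trans (*-congʳ (≋⇒≈ₚ annihilates-constants 0)) (zeroˡ _)
        term≈0 (suc j) _ = trans (*-congˡ (hasse-degreeBelow p (suc j) deg<n+1+j i n≤i)) (zeroʳ _)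
          where
          deg<n+1+j : DegreeBelow (n ℕ.+ suc j) p
          deg<n+1+j = degreeBelow-mono {p = p} (ℕP.≤-trans (s≤s (ℕP.m≤m+n n j)) (ℕP.≤-reflexive (≡.sym (ℕP.+-suc n j)))) deg<1+n

      ^-lowers-degree : ∀ m {n} p → DegreeBelow (m ℕ.+ n) p → DegreeBelow n ((Q ^ₒ m) p)
      ^-lowers-degree zero    p deg = deg
      ^-lowers-degree (suc m) {n} p deg =
        lowers-degree ((Q ^ₒ m) p) (^-lowers-degree m p (degreeBelow-mono {p = p} (ℕP.≤-reflexive (≡.sym (ℕP.+-suc m n))) deg))

      ^-annihilates : ∀ {m} p → length p ≤ m → (Q ^ₒ m) p ≋ []
      ^-annihilates {m} p len≤m =
        degreeBelow-0 (^-lowers-degree m p (degreeBelow-mono {p = p} (ℕP.≤-trans len≤m (ℕP.m≤m+n m 0)) (degreeBelow-length p)))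

      eval-seriesQ : ∀ as b p {n} → length p ≤ n → eval b (seriesQ as Q p) ≈ ∑[ j < n ] (as j * eval b ((Q ^ₒ j) p))
      eval-seriesQ as b p {n} len≤n = begin
        eval b (sumₚ (length p) (λ j → scale (as j) ((Q ^ₒ j) p)))   ≈⟨ eval-sumₚ b (length p) _ ⟩
        ∑[ j < length p ] eval b (scale (as j) ((Q ^ₒ j) p))          ≈⟨ ∑-cong (length p) (λ j → eval-scale b (as j) ((Q ^ₒ j) p)) ⟩
        ∑[ j < length p ] (as j * eval b ((Q ^ₒ j) p))                ≈⟨ ∑-extend n len≤n (λ j len≤j → trans (*-congˡ (eval-cong (^-annihilates p len≤j))) (zeroʳ _)) ⟨
        ∑[ j < n ] (as j * eval b ((Q ^ₒ j) p))                       ∎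
        where open ≈-Reasoning

    quotient-cancel : ∀ {Q R T} → IsLinear R → IsQuotient Q R T → ∀ p → R (T p) ≋ Q p
    quotient-cancel {Q} {R} {T} linR (P , S , S⁻¹ , (linP , invP) , (linS , invS) , _ , DP≈Q , DS≈R , SS⁻¹≈1 , _ , T≈PS⁻¹) p = begin
      R (T p)             ≈⟨ LinearOperator.T-cong linR (≈ₚ⇒≋ (T≈PS⁻¹ p)) ⟩
      R (P (S⁻¹ p))       ≈⟨ ≈ₚ⇒≋ (DS≈R (P (S⁻¹ p))) ⟨
      D (S (P (S⁻¹ p)))   ≈⟨ D-cong (shiftInvariant-comm linS invS linP invP (S⁻¹ p)) ⟩
      D (P (S (S⁻¹ p)))   ≈⟨ D-cong (LinearOperator.T-cong linP (≈ₚ⇒≋ (SS⁻¹≈1 p))) ⟩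
      D (P p)             ≈⟨ ≈ₚ⇒≋ (DP≈Q p) ⟩
      Q p                 ∎
      where open ≋-Reasoning

    sigma-∘-quotient : ∀ {Q R T R⁻¹} → IsLinear R → IsQuotient Q R T → IsSigma R R⁻¹ →
                       ∀ p → R⁻¹ (Q p) ≋ (idₒ -ₒ 𝓔 0#) (T p)
    sigma-∘-quotient {Q} {R} {T} {R⁻¹} linR quotient (linR⁻¹ , _ , R⁻¹R≈1-𝓔₀) p = begin
      R⁻¹ (Q p)             ≈⟨ LinearOperator.T-cong linR⁻¹ (quotient-cancel {Q} {R} {T} linR quotient p) ⟨
      R⁻¹ (R (T p))         ≈⟨ ≈ₚ⇒≋ (R⁻¹R≈1-𝓔₀ (T p)) ⟩
      (idₒ -ₒ 𝓔 0#) (T p)   ∎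
      where open ≋-Reasoning

    module _ {Q R R⁻¹ : Op} {as : ℕ → Carrier}
             (linQ : IsLinear Q) (invQ : ShiftInvariant Q) {k : Carrier} (QX≈k : Q X ≈ₚ (k ∷ []))
             (linR : IsLinear R) (quotient : IsQuotient Q R (seriesQ as Q)) (σR : IsSigma R R⁻¹) where
      open DeltaOperator linQ invQ QX≈k

      eval-sigma-quotient : ∀ {h} → eval 0# h ≈ 0# → ∀ c →
        eval c (R⁻¹ (Q h)) ≈ as 0 * eval c h + ∑[ j < length h ] (as (suc j) * (eval c ((Q ^ₒ suc j) h) - eval 0# ((Q ^ₒ suc j) h)))
      eval-sigma-quotient {h} h[0]≈0 c = begin
        eval c (R⁻¹ (Q h))                                         ≈⟨ eval-cong (sigma-∘-quotient {Q} {R} {seriesQ as Q} {R⁻¹} linR quotient σR h) ⟩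
        eval c ((idₒ -ₒ 𝓔 0#) (seriesQ as Q h))                    ≈⟨ eval-id-𝓔 c 0# (seriesQ as Q h) ⟩
        eval c (seriesQ as Q h) - eval 0# (seriesQ as Q h)         ≈⟨ +-cong (eval-seriesQ as c h (ℕP.n≤1+n _)) (-‿cong (eval-seriesQ as 0# h (ℕP.n≤1+n _))) ⟩
        ∑[ j < suc L ] (as j * eval c (Qʲh j)) - ∑[ j < suc L ] (as j * eval 0# (Qʲh j))   ≈⟨ ∑-distrib-- (suc L) _ _ ⟨
        ∑[ j < suc L ] (as j * eval c (Qʲh j) - as j * eval 0# (Qʲh j))                  ≈⟨ ∑-cong (suc L) (λ j → factor (as j) _ _) ⟩
        ∑[ j < suc L ] (as j * (eval c (Qʲh j) - eval 0# (Qʲh j)))                       ≈⟨ ∑-suc L _ ⟩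
        as 0 * (eval c h - eval 0# h) + ∑[ j < L ] (as (suc j) * (eval c (Qʲh (suc j)) - eval 0# (Qʲh (suc j))))
          ≈⟨ +-congʳ (*-congˡ (trans (+-congˡ (trans (-‿cong h[0]≈0) -0#≈0#)) (+-identityʳ _))) ⟩
        as 0 * eval c h + ∑[ j < L ] (as (suc j) * (eval c (Qʲh (suc j)) - eval 0# (Qʲh (suc j)))) ∎
        where
        open ≈-Reasoning
        L = length h
        Qʲh : ℕ → Poly
        Qʲh j = (Q ^ₒ j) h
        factor : ∀ x y z → x * y - x * z ≈ x * (y - z)
        factor = solve 3 (λ x y z → x :* y :- x :* z := x :* (y :- z)) refl

      eval-conj-sigma-difference : ∀ {Q⁻¹} → IsSigma Q Q⁻¹ → ∀ a f b →
        eval b (conj a R⁻¹ f -ₚ scale (as 0) (conj a Q⁻¹ f)) ≈ ∑[ j < length f ] (as (suc j) * (eval b ((Q ^ₒ j) f) - eval a ((Q ^ₒ j) f)))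
      eval-conj-sigma-difference {Q⁻¹} σQ@(_ , QQ⁻¹≈1 , _) a f b = begin
        eval b (conj a R⁻¹ f -ₚ scale (as 0) (conj a Q⁻¹ f))
          ≈⟨ eval--ₚ b (conj a R⁻¹ f) (scale (as 0) (conj a Q⁻¹ f)) ⟩
        eval b (E (- a) (R⁻¹ g)) - eval b (scale (as 0) (E (- a) h))
          ≈⟨ +-cong (eval-E b (- a) (R⁻¹ g)) (-‿cong (trans (eval-scale b (as 0) (E (- a) h)) (*-congˡ (eval-E b (- a) h)))) ⟩
        eval (b - a) (R⁻¹ g) - as 0 * eval (b - a) h
          ≈⟨ +-congʳ (eval-cong (LinearOperator.T-cong (proj₁ σR) Qh≋g)) ⟨
        eval (b - a) (R⁻¹ (Q h)) - as 0 * eval (b - a) h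
          ≈⟨ +-congʳ (eval-sigma-quotient (sigma-vanishes-at-0 σQ g) (b - a)) ⟩
        (as 0 * eval (b - a) h + ∑[ j < length h ] shifted j) - as 0 * eval (b - a) h
          ≈⟨ solve 2 (λ x y → (x :+ y) :- x := y) refl _ _ ⟩
        ∑[ j < length h ] shifted j
          ≈⟨ ∑-cong (length h) shifted≈term ⟩
        ∑[ j < length h ] term j
          ≈⟨ ∑-tail-irrelevant (length h) (length f) term≈0ₕ term≈0f ⟩
        ∑[ j < length f ] term j
          ∎
        where
        open ≈-Reasoning
        g = E a f
        h = Q⁻¹ g
        Qh≋g : Q h ≋ g
        Qh≋g = ≈ₚ⇒≋ (QQ⁻¹≈1 g)
        eval-Q¹⁺ʲh : ∀ x j → eval x ((Q ^ₒ suc j) h) ≈ eval (x + a) ((Q ^ₒ j) f)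
        eval-Q¹⁺ʲh x j = trans (eval-cong (^-suc-shift invQ a Qh≋g j)) (eval-E x a ((Q ^ₒ j) f))
        shifted term : ℕ → Carrier
        shifted j = as (suc j) * (eval (b - a) ((Q ^ₒ suc j) h) - eval 0# ((Q ^ₒ suc j) h))
        term j = as (suc j) * (eval b ((Q ^ₒ j) f) - eval a ((Q ^ₒ j) f))
        shifted≈term : ∀ j → shifted j ≈ term j
        shifted≈term j = *-congˡ (+-cong
          (trans (eval-Q¹⁺ʲh (b - a) j) (eval-cong-point ((Q ^ₒ j) f) (solve 2 (λ b a → b :- a :+ a := b) refl b a)))
          (-‿cong (trans (eval-Q¹⁺ʲh 0# j) (eval-cong-point ((Q ^ₒ j) f) (+-identityˡ a)))))
        term≈0ₕ : ∀ j → length h ≤ j → term j ≈ 0#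
        term≈0ₕ j len≤j = trans (sym (shifted≈term j))
          (trans (*-congˡ (eval-difference-≋[] (b - a) 0# (^-annihilates h (ℕP.m≤n⇒m≤1+n len≤j)))) (zeroʳ _))
        term≈0f : ∀ j → length f ≤ j → term j ≈ 0#
        term≈0f j len≤j = trans (*-congˡ (eval-difference-≋[] b a (^-annihilates f len≤j))) (zeroʳ _)

mainTheorem12 : ∀ {c ℓ : Level} (F : Field c ℓ) → Umbral.CharZero F →
    let open Field F in let open Umbral F in
    ∀ (Q R : Op) (a : Carrier) (as : ℕ → Carrier) (Qσ Rσ : Op) →
    IsDelta Q → IsDelta R →
    IsQuotient Q R (seriesQ as Q) →
    IsSigma Q Qσ → IsSigma R Rσ →
    ∀ f → conj a Rσ f -ₚ scale (as 0) (conj a Qσ f)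
          ≈ₚ sumₚ (length f) (λ j → scale (as (suc j)) ((idₒ -ₒ 𝓔 a) ((Q ^ₒ j) f)))
mainTheorem12 F char0 Q R a as Qσ Rσ (linQ , invQ , _ , _ , QX≈k) (linR , _) quotient σQ σR f =
  ≋⇒≈ₚ (eval-injective char0 lhs rhs λ b → trans
    (eval-conj-sigma-difference char0 linQ invQ QX≈k linR quotient σR σQ a f b)
    (sym (eval-sumₚ-id-𝓔 b a (length f) (λ j → as (suc j)) (λ j → (Q ^ₒ j) f))))
  where
  open Field F using (trans; sym)
  open Umbral F
  open UmbralCalculus F
  lhs rhs : Poly
  lhs = conj a Rσ f -ₚ scale (as 0) (conj a Qσ f)
  rhs = sumₚ (length f) (λ j → scale (as (suc j)) ((idₒ -ₒ 𝓔 a) ((Q ^ₒ j) f)))
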